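{- Let $G$ be a finite simple connected graph of order $n$, let $k\ge 0$ be an integer, and suppose that $G$ contains an isometric path $P=(x_0,x_1,\ldots,x_\ell)$, i.e. $d_G(x_i,x_j)=|i-j|$ for all $0\le i<j\le \ell$. Then $\mu_k(G)\le n-\ell+k+1$.
   Context: For $X\subseteq V(G)$ and an integer $k\ge 0$, two vertices $u,v\in V(G)$ are called $(X,k)$-visible if there exists a shortest $(u,v)$-path in $G$ having at most $k$ internal vertices that lie in $X$. A set $X\subseteq V(G)$ is a mutual $k$-visible set if every pair of distinct vertices of $X$ is $(X,k)$-visible. The mutual $k$-visibility number $\mu_k(G)$ is the maximum cardinality of a mutual $k$-visible set in $G$. -}

module Defs where

open import Data.Nat using (ℕ; zero; suc; _≤_; _∸_)
open import Data.Fin using (Fin; toℕ; _<_)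
open import Data.Fin.Subset using (Subset; _∈_)
open import Data.Fin.Subset.Properties using (_∈?_)
open import Data.List using (List; []; _∷_; length; filter)
open import Data.Product using (Σ; ∃; _×_)
open import Relation.Binary.PropositionalEquality using (_≡_)
open import Relation.Nullary using (¬_)

record Graph (n : ℕ) : Set₁ where
  field
    Adj     : Fin n → Fin n → Set
    sym     : ∀ {u v} → Adj u v → Adj v u
    irrefl  : ∀ {u} → ¬ Adj u u

module _ {n : ℕ} (G : Graph n) where
  open Graph G

  data Walk : Fin n → Fin n → Set where
    []  : ∀ {u} → Walk u u
    _∷_ : ∀ {u v w} → Adj u v → Walk v w → Walk u w

  len : ∀ {u w} → Walk u w → ℕ
  len []      = zero
  len (_ ∷ p) = suc (len p)

  initVerts : ∀ {u w} → Walk u w → List (Fin n)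
  initVerts []                = []
  initVerts (_∷_ {u = u} _ p) = u ∷ initVerts p

  -- internal vertices of a walk (all vertices except the first and last)
  internal : ∀ {u w} → Walk u w → List (Fin n)
  internal []      = []
  internal (_ ∷ p) = initVerts p

  -- a shortest (u,w)-walk (= shortest path)
  Shortest : ∀ {u w} → Walk u w → Set
  Shortest {u} {w} p = ∀ (q : Walk u w) → len p ≤ len q

  Dist : Fin n → Fin n → ℕ → Set
  Dist u v m = Σ (Walk u v) (λ p → Shortest p × len p ≡ m)

  Connected : Set
  Connected = ∀ (u v : Fin n) → Walk u v

  internalIn : ∀ {u w} → Subset n → Walk u w → ℕ
  internalIn X p = length (filter (_∈? X) (internal p))

  Visible : Subset n → ℕ → Fin n → Fin n → Set
  Visible X k u v = Σ (Walk u v) (λ p → Shortest p × internalIn X p ≤ k)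

  MutualVisible : ℕ → Subset n → Set
  MutualVisible k X = ∀ u v → u ∈ X → v ∈ X → ¬ u ≡ v → Visible X k u v

  IsometricPath : (ℓ : ℕ) → (Fin (suc ℓ) → Fin n) → Set
  IsometricPath ℓ x = ∀ (i j : Fin (suc ℓ)) → i < j →
    Dist (x i) (x j) (toℕ j ∸ toℕ i)

{-# OPTIONS --safe #-}
-- Measure every vertex by its distance f from x₀ and call the layer f⁻¹(j) full when it lies
-- inside X.  A layer that is not full contains a vertex outside X, so among the layers 0, …, ℓ
-- (all nonempty, thanks to the path) at most n - |X| are not full.  Since f changes by at most
-- one along an edge, every walk between the vertices of the path in the first and the last full
-- layer has an interior vertex in each full layer strictly between them, all of which lie in X;
-- mutual k-visibility therefore allows at most k + 2 full layers.  Altogether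
-- ℓ + 1 ≤ (n - |X|) + (k + 2).
module Submission where

open import Defs
open import Data.Nat using (ℕ; suc; _+_; _∸_; _≤_)
open import Data.Fin using (Fin)
open import Data.Fin.Subset using (Subset; ∣_∣)

open import Data.Bool using (if_then_else_)
open import Data.Fin as Fin using (toℕ; fromℕ<)
open import Data.Fin.Properties using (toℕ-fromℕ<; all?; ¬∀⟶∃¬; sequence)
open import Data.Fin.Subset using (_∈_; _∉_; _⊆_; _⊂_; ∁)
open import Data.Fin.Subset.Properties
  using (_∈?_; p⊆q⇒∣p∣≤∣q∣; p⊂q⇒∣p∣<∣q∣; ∣∁p∣≡n∸∣p∣; ∣p∣≤n; x∉p⇒x∈∁p)
open import Data.List using (List; _∷_; length; filter)
open import Data.Nat using (zero; _<_; z≤n; s≤s; z<s; _≤′_; ≤′-refl; ≤′-step; _≤?_; _<?_; _≟_)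
open import Data.Nat.Properties
open import Data.Nat.Tactic.RingSolver using (solve-∀)
open import Data.Product using (Σ; ∃; _×_; _,_; proj₁; proj₂; map₁; map₂)
open import Data.Vec using ([]; _∷_; here; there)
open import Effect.Monad using (RawMonad)
open import Function using (_∘_; const)
open import Level using (0ℓ)
open import Relation.Binary.PropositionalEquality
open import Relation.Nullary using (¬_; yes; no; does; ¬?; _×-dec_; _→-dec_; contradiction)
open import Relation.Nullary.Decidable using (decidable-stable; ¬¬-excluded-middle)
open import Relation.Nullary.Negation using (¬¬-Monad; ¬¬-map)
open import Relation.Unary using (Pred; Decidable)

toSubset : ∀ {n p} {P : Pred (Fin n) p} → Decidable P → Subset n
toSubset {zero}  P? = []
toSubset {suc n} P? = does (P? Fin.zero) ∷ toSubset (P? ∘ Fin.suc)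

∈-toSubset⁺ : ∀ {n p} {P : Pred (Fin n) p} (P? : Decidable P) {v} → P v → v ∈ toSubset P?
∈-toSubset⁺ P? {Fin.zero} Pv with P? Fin.zero
... | yes _  = here
... | no ¬Pv = contradiction Pv ¬Pv
∈-toSubset⁺ P? {Fin.suc v} Pv = there (∈-toSubset⁺ (P? ∘ Fin.suc) Pv)

∈-toSubset⁻ : ∀ {n p} {P : Pred (Fin n) p} (P? : Decidable P) {v} → v ∈ toSubset P? → P v
∈-toSubset⁻ P? {Fin.zero} v∈ with P? Fin.zero
... | yes Pv = Pv
∈-toSubset⁻ P? {Fin.zero} () | no _
∈-toSubset⁻ P? {Fin.suc v} (there v∈) = ∈-toSubset⁻ (P? ∘ Fin.suc) v∈

module CountBelow {p} {P : Pred ℕ p} (P? : Decidable P) where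

  countBelow : ℕ → ℕ
  countBelow zero    = zero
  countBelow (suc t) = if does (P? t) then suc (countBelow t) else countBelow t

  countBelow-accept : ∀ {t} → P t → countBelow (suc t) ≡ suc (countBelow t)
  countBelow-accept {t} Pt with P? t
  ... | yes _  = refl
  ... | no ¬Pt = contradiction Pt ¬Pt

  countBelow-reject : ∀ {t} → ¬ P t → countBelow (suc t) ≡ countBelow t
  countBelow-reject {t} ¬Pt with P? t
  ... | yes Pt = contradiction Pt ¬Pt
  ... | no _   = refl

  countBelow-suc≤ : ∀ t → countBelow (suc t) ≤ suc (countBelow t)
  countBelow-suc≤ t with P? t
  ... | yes _ = ≤-refl
  ... | no _  = n≤1+n _

  countBelow-mono : ∀ {s t} → s ≤ t → countBelow s ≤ countBelow t
  countBelow-mono = mono ∘ ≤⇒≤′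
    where
    countBelow-≤-suc : ∀ t → countBelow t ≤ countBelow (suc t)
    countBelow-≤-suc t with P? t
    ... | yes _ = n≤1+n _
    ... | no _  = ≤-refl
    mono : ∀ {s t} → s ≤′ t → countBelow s ≤ countBelow t
    mono ≤′-refl         = ≤-refl
    mono (≤′-step s≤′t) = ≤-trans (mono s≤′t) (countBelow-≤-suc _)

  countBelow-<⇒< : ∀ {s t} → countBelow s < countBelow t → s < t
  countBelow-<⇒< lt = ≰⇒> (<⇒≱ lt ∘ countBelow-mono)

  countBelow-select : ∀ {m} t → m < countBelow t → ∃ λ a → a < t × P a × countBelow a ≡ m
  countBelow-select {m} (suc t) m<c with m <? countBelow t
  ... | yes m<c′ = map₂ (map₁ m<n⇒m<1+n) (countBelow-select t m<c′)
  ... | no m≮c′ with P? t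
  ...   | yes Pt = t , ≤-refl , Pt , ≤-antisym (≮⇒≥ m≮c′) (≤-pred m<c)
  ...   | no _   = contradiction m<c m≮c′

module _ {n} (G : Graph n) where
  open Graph G using (Adj)

  _∷ʳ_ : ∀ {u v w} → Walk G u v → Adj v w → Walk G u w
  []       ∷ʳ e = e ∷ []
  (e′ ∷ p) ∷ʳ e = e′ ∷ (p ∷ʳ e)

  len-∷ʳ : ∀ {u v w} (p : Walk G u v) (e : Adj v w) → len G (p ∷ʳ e) ≡ suc (len G p)
  len-∷ʳ []       e = refl
  len-∷ʳ (e′ ∷ p) e = cong suc (len-∷ʳ p e)

  []-shortest : ∀ {u} → Shortest G ([] {u = u})
  []-shortest _ = z≤n

  shortest-len-unique : ∀ {u v} {p q : Walk G u v} → Shortest G p → Shortest G q → len G p ≡ len G q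
  shortest-len-unique p-shortest q-shortest = ≤-antisym (p-shortest _) (q-shortest _)

  -- Adjacency is not decidable, so a shortest walk exists only in the double-negation monad.
  ¬¬-shortest : ∀ {u v} → Walk G u v → ¬ ¬ Σ (Walk G u v) (Shortest G)
  ¬¬-shortest p = shortest-within (len G p) p ≤-refl
    where
    open RawMonad (¬¬-Monad {a = 0ℓ})
    shortest-within : ∀ {u v} m (p : Walk G u v) → len G p ≤ m → ¬ ¬ Σ (Walk G u v) (Shortest G)
    shortest-within zero    p len≤0   = pure (p , λ q → ≤-trans len≤0 z≤n)
    shortest-within {u} {v} (suc m) p len≤1+m =
      ¬¬-excluded-middle {A = ∃ λ (q : Walk G u v) → len G q < len G p} >>= λ
        { (yes (q , q<p)) → shortest-within m q (≤-pred (≤-trans q<p len≤1+m))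
        ; (no ∄q<p)       → pure (p , λ q → ≮⇒≥ (λ q<p → ∄q<p (q , q<p)))
        }

  module DistanceFrom {s} (shortest : ∀ v → Σ (Walk G s v) (Shortest G)) where

    dist : Fin n → ℕ
    dist v = len G (proj₁ (shortest v))

    dist-step : ∀ {u v} → Adj u v → dist v ≤ suc (dist u)
    dist-step {u} e = ≤-trans (proj₂ (shortest _) (proj₁ (shortest u) ∷ʳ e)) (≤-reflexive (len-∷ʳ _ e))

    dist-shortest : ∀ {v} {p : Walk G s v} → Shortest G p → dist v ≡ len G p
    dist-shortest = shortest-len-unique (proj₂ (shortest _))

  module _ {ℓ} {x : Fin (suc ℓ) → Fin n} (iso : IsometricPath G ℓ x)
           (shortest : ∀ v → Σ (Walk G (x Fin.zero) v) (Shortest G)) where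
    open DistanceFrom shortest

    isometricPath-dist : ∀ i → dist (x i) ≡ toℕ i
    isometricPath-dist Fin.zero    = dist-shortest []-shortest
    isometricPath-dist (Fin.suc i) with iso Fin.zero (Fin.suc i) z<s
    ... | p , p-shortest , len-p = trans (dist-shortest p-shortest) len-p

    isometricPath-layers : ∀ j → j ≤ ℓ → ∃ λ v → dist v ≡ j
    isometricPath-layers j j≤ℓ = x i , trans (isometricPath-dist i) (toℕ-fromℕ< (s≤s j≤ℓ))
      where i = fromℕ< (s≤s j≤ℓ)

∸-bound-swap : ∀ {s n ℓ k} → s ≤ n → suc ℓ ≤ n ∸ s + (2 + k) → s ≤ n ∸ ℓ + k + 1
∸-bound-swap {s} {n} {ℓ} {k} s≤n ℓ<n∸s+2+k = +-cancelʳ-≤ (suc ℓ) s (n ∸ ℓ + k + 1) (begin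
  s + suc ℓ                  ≤⟨ +-monoʳ-≤ s ℓ<n∸s+2+k ⟩
  s + (n ∸ s + (2 + k))      ≡⟨ +-assoc s (n ∸ s) (2 + k) ⟨
  s + (n ∸ s) + (2 + k)      ≡⟨ cong (_+ (2 + k)) (m+[n∸m]≡n s≤n) ⟩
  n + (2 + k)                ≤⟨ +-monoˡ-≤ (2 + k) (m≤n+m∸n n ℓ) ⟩
  ℓ + (n ∸ ℓ) + (2 + k)      ≡⟨ rearrange ℓ (n ∸ ℓ) k ⟩
  n ∸ ℓ + k + 1 + suc ℓ      ∎)
  where
  open ≤-Reasoning
  rearrange : ∀ a b c → a + b + (2 + c) ≡ b + c + 1 + suc a
  rearrange = solve-∀

module Layers {n} (G : Graph n) (f : Fin n → ℕ)
              (f-step : ∀ {u v} → Graph.Adj G u v → f v ≤ suc (f u)) (X : Subset n) where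

  Full : ℕ → Set
  Full j = ∀ v → f v ≡ j → v ∈ X

  full? : Decidable Full
  full? j = all? (λ v → f v ≟ j →-dec v ∈? X)

  open CountBelow full? renaming
    ( countBelow to fullBelow; countBelow-accept to fullBelow-accept
    ; countBelow-reject to fullBelow-reject; countBelow-suc≤ to fullBelow-suc≤
    ; countBelow-mono to fullBelow-mono; countBelow-<⇒< to fullBelow-<⇒<
    ; countBelow-select to fullBelow-select )

  ¬Full⇒∃outside : ∀ {j} → ¬ Full j → ∃ λ v → f v ≡ j × v ∉ X
  ¬Full⇒∃outside {j} ¬full with ¬∀⟶∃¬ n _ (λ v → f v ≟ j →-dec v ∈? X) ¬full
  ... | v , ¬[fv≡j→v∈X] =
    v , decidable-stable (f v ≟ j) (λ fv≢j → ¬[fv≡j→v∈X] (λ fv≡j → contradiction fv≡j fv≢j))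
      , ¬[fv≡j→v∈X] ∘ const

  outsideBelow : ℕ → Subset n
  outsideBelow t = toSubset (λ v → ¬? (v ∈? X) ×-dec f v <? t)

  outsideBelow⊆∁ : ∀ t → outsideBelow t ⊆ ∁ X
  outsideBelow⊆∁ t = x∉p⇒x∈∁p ∘ proj₁ ∘ ∈-toSubset⁻ _

  outsideBelow-⊆-suc : ∀ t → outsideBelow t ⊆ outsideBelow (suc t)
  outsideBelow-⊆-suc t = ∈-toSubset⁺ _ ∘ map₂ m<n⇒m<1+n ∘ ∈-toSubset⁻ _

  outsideBelow-⊂-suc : ∀ {t} → ¬ Full t → outsideBelow t ⊂ outsideBelow (suc t)
  outsideBelow-⊂-suc {t} ¬full with ¬Full⇒∃outside ¬full
  ... | v , refl , v∉X =
    outsideBelow-⊆-suc t , v , ∈-toSubset⁺ _ (v∉X , ≤-refl) , <-irrefl refl ∘ proj₂ ∘ ∈-toSubset⁻ _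

  layers-below : ∀ t → t ≤ ∣ outsideBelow t ∣ + fullBelow t
  layers-below zero = z≤n
  layers-below (suc t) with full? t
  ... | yes full = begin
    suc t                                        ≤⟨ s≤s (layers-below t) ⟩
    suc (∣ outsideBelow t ∣ + fullBelow t)        ≡⟨ +-suc _ _ ⟨
    ∣ outsideBelow t ∣ + suc (fullBelow t)        ≤⟨ +-monoˡ-≤ _ (p⊆q⇒∣p∣≤∣q∣ (outsideBelow-⊆-suc t)) ⟩
    ∣ outsideBelow (suc t) ∣ + suc (fullBelow t)  ≡⟨ cong (∣ outsideBelow (suc t) ∣ +_) (fullBelow-accept full) ⟨
    ∣ outsideBelow (suc t) ∣ + fullBelow (suc t)  ∎
    where open ≤-Reasoning
  ... | no ¬full = begin
    suc t                                        ≤⟨ s≤s (layers-below t) ⟩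
    suc (∣ outsideBelow t ∣ + fullBelow t)        ≤⟨ +-monoˡ-≤ _ (p⊂q⇒∣p∣<∣q∣ (outsideBelow-⊂-suc ¬full)) ⟩
    ∣ outsideBelow (suc t) ∣ + fullBelow t        ≡⟨ cong (∣ outsideBelow (suc t) ∣ +_) (fullBelow-reject ¬full) ⟨
    ∣ outsideBelow (suc t) ∣ + fullBelow (suc t)  ∎
    where open ≤-Reasoning

  countIn : List (Fin n) → ℕ
  countIn vs = length (filter (_∈? X) vs)

  fullBelow-vertex : ∀ v vs → fullBelow (suc (f v)) + countIn vs ≤ fullBelow (f v) + countIn (v ∷ vs)
  -- Matching on v ∈? X makes countIn (v ∷ vs) compute.
  fullBelow-vertex v vs with v ∈? X
  ... | yes _ = begin
    fullBelow (suc (f v)) + countIn vs  ≤⟨ +-monoˡ-≤ _ (fullBelow-suc≤ (f v)) ⟩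
    suc (fullBelow (f v)) + countIn vs  ≡⟨ +-suc _ _ ⟨
    fullBelow (f v) + suc (countIn vs)  ∎
    where open ≤-Reasoning
  ... | no v∉X = ≤-reflexive (cong (_+ countIn vs) (fullBelow-reject (λ full → v∉X (full v refl))))

  fullBelow-initVerts : ∀ {v w} (q : Walk G v w) → fullBelow (f w) ≤ fullBelow (f v) + countIn (initVerts G q)
  fullBelow-initVerts [] = m≤m+n _ 0
  fullBelow-initVerts {v} {w} (_∷_ {v = v′} e q) = begin
    fullBelow (f w)                                  ≤⟨ fullBelow-initVerts q ⟩
    fullBelow (f v′) + countIn (initVerts G q)       ≤⟨ +-monoˡ-≤ _ (fullBelow-mono (f-step e)) ⟩
    fullBelow (suc (f v)) + countIn (initVerts G q)  ≤⟨ fullBelow-vertex v (initVerts G q) ⟩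
    fullBelow (f v) + countIn (v ∷ initVerts G q)    ∎
    where open ≤-Reasoning

  fullBelow-walk : ∀ {u w} (p : Walk G u w) → fullBelow (f w) ≤ fullBelow (suc (f u)) + internalIn G X p
  fullBelow-walk {u} []  = ≤-trans (fullBelow-mono (n≤1+n (f u))) (m≤m+n _ 0)
  fullBelow-walk (e ∷ q) = ≤-trans (fullBelow-initVerts q) (+-monoˡ-≤ _ (fullBelow-mono (f-step e)))

  module _ {ℓ k} (layer-nonempty : ∀ j → j ≤ ℓ → ∃ λ v → f v ≡ j) (visible : MutualVisible G k X) where

    fullBelow-gap : ∀ {a b} → a < b → b ≤ ℓ → Full a → Full b → fullBelow b ≤ suc (fullBelow a) + k
    fullBelow-gap a<b b≤ℓ full-a full-b
      with layer-nonempty _ (≤-trans (<⇒≤ a<b) b≤ℓ) | layer-nonempty _ b≤ℓ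
    ... | u , refl | w , refl with visible u w (full-a u refl) (full-b w refl) (λ u≡w → <-irrefl (cong f u≡w) a<b)
    ... | p , _ , p≤k = begin
      fullBelow (f w)                           ≤⟨ fullBelow-walk p ⟩
      fullBelow (suc (f u)) + internalIn G X p  ≤⟨ +-mono-≤ (fullBelow-suc≤ (f u)) p≤k ⟩
      suc (fullBelow (f u)) + k                 ∎
      where open ≤-Reasoning

    fullBelow-bound : fullBelow (suc ℓ) ≤ 2 + k
    fullBelow-bound with fullBelow (suc ℓ) in c≡
    ... | zero        = z≤n
    ... | suc zero    = s≤s z≤n
    ... | suc (suc c)
      with fullBelow-select (suc ℓ) (subst (0 <_) (sym c≡) z<s)
         | fullBelow-select (suc ℓ) (subst (suc c <_) (sym c≡) ≤-refl)
    ... | a , _ , full-a , a-first | b , b≤ℓ , full-b , b-last = s≤s (begin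
      suc c                    ≡⟨ b-last ⟨
      fullBelow b              ≤⟨ fullBelow-gap a<b (≤-pred b≤ℓ) full-a full-b ⟩
      suc (fullBelow a) + k    ≡⟨ cong (λ m → suc m + k) a-first ⟩
      suc k                    ∎)
      where
      open ≤-Reasoning
      a<b : a < b
      a<b = fullBelow-<⇒< (subst₂ _<_ (sym a-first) (sym b-last) z<s)

    mutualVisible-bound : ∣ X ∣ ≤ n ∸ ℓ + k + 1
    mutualVisible-bound = ∸-bound-swap (∣p∣≤n X) (begin
      suc ℓ                                          ≤⟨ layers-below (suc ℓ) ⟩
      ∣ outsideBelow (suc ℓ) ∣ + fullBelow (suc ℓ)   ≤⟨ +-mono-≤ outside-bound fullBelow-bound ⟩
      n ∸ ∣ X ∣ + (2 + k)                            ∎)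
      where
      open ≤-Reasoning
      outside-bound : ∣ outsideBelow (suc ℓ) ∣ ≤ n ∸ ∣ X ∣
      outside-bound = ≤-trans (p⊆q⇒∣p∣≤∣q∣ (outsideBelow⊆∁ (suc ℓ))) (≤-reflexive (∣∁p∣≡n∸∣p∣ X))

theorem3p11 : (n : ℕ) (G : Graph n) → Connected G → (k ℓ : ℕ) →
    (x : Fin (suc ℓ) → Fin n) → IsometricPath G ℓ x →
    (X : Subset n) → MutualVisible G k X → ∣ X ∣ ≤ n ∸ ℓ + k + 1
theorem3p11 n G connected k ℓ x iso X visible =
  decidable-stable (∣ X ∣ ≤? n ∸ ℓ + k + 1)
    (¬¬-map bound (sequence (RawMonad.rawApplicative ¬¬-Monad) (¬¬-shortest G ∘ connected (x Fin.zero))))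
  where
  bound : (∀ v → Σ (Walk G (x Fin.zero) v) (Shortest G)) → ∣ X ∣ ≤ n ∸ ℓ + k + 1
  bound shortest =
    Layers.mutualVisible-bound G dist dist-step X (isometricPath-layers G iso shortest) visible
    where open DistanceFrom G shortest
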